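{- Let $B=5$, let $\tilde p>0$ be an integer and $\tilde q$ a positive integer with $\tilde q\geqslant 3600\sqrt[3]{|\tilde p|}$ and $2\tilde q>\tilde p$. Let $F_1=B^{2}\tilde q^{6}+2B\tilde q^{4}-2B\tilde p\tilde q^{3}-2\tilde q^{2}-2\tilde p\tilde q+\tilde p^{2}+\frac5B-\frac{20}{B^{2}\tilde q^{2}}$. Then there is no integer $t$ with $F_1<t<F_1+\frac{10\tilde p}{B^{2}\tilde q^{3}}$. -}

module Defs where

open import Data.Nat as ℕ using (ℕ; NonZero)
open import Data.Nat.Properties using (m*n≢0)
open import Data.Integer using (ℤ; +_)
open import Data.Rational using (ℚ; _/_; _+_; _*_; _-_)

B : ℕ
B = 5

⟦_⟧ : ℕ → ℚ
⟦ n ⟧ = + n / 1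

F₁ : (p q : ℕ) → .{{NonZero q}} → ℚ
F₁ p q =
  let P = ⟦ p ⟧ ; Q = ⟦ q ⟧ ; b = ⟦ B ⟧
      Q2 = Q * Q ; Q3 = Q2 * Q ; Q4 = Q3 * Q ; Q6 = Q4 * Q2
      d = B ℕ.* B ℕ.* (q ℕ.* q)
      instance
        qq : NonZero (q ℕ.* q)
        qq = m*n≢0 q q
        dd : NonZero d
        dd = m*n≢0 (B ℕ.* B) (q ℕ.* q)
  in b * b * Q6 + ⟦ 2 ⟧ * b * Q4 - ⟦ 2 ⟧ * b * P * Q3 - ⟦ 2 ⟧ * Q2
     - ⟦ 2 ⟧ * P * Q + P * P + (+ 5 / B) - (+ 20 / d)

gap : (p q : ℕ) → .{{NonZero q}} → ℚ
gap p q =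
  let instance
        qq : NonZero (q ℕ.* q)
        qq = m*n≢0 q q
        qqq : NonZero (q ℕ.* q ℕ.* q)
        qqq = m*n≢0 (q ℕ.* q) q
        dd : NonZero (B ℕ.* B ℕ.* (q ℕ.* q ℕ.* q))
        dd = m*n≢0 (B ℕ.* B) (q ℕ.* q ℕ.* q)
  in + (10 ℕ.* p) / (B ℕ.* B ℕ.* (q ℕ.* q ℕ.* q))

{-# OPTIONS --safe #-}
module Submission where

-- With B = 5 the constant 5/B is 1, so F₁ is an integer polynomial in p and q minus
-- δ = 20/(B²q²) ∈ (0, 1]. Because p < 2q the gap 10p/(B²q³) is at most δ, hence the
-- open interval (F₁, F₁ + gap) lies inside (n − 1, n) for the integer n = F₁ + δ.

open import Defs
open import Data.Nat using (ℕ; _≤_; _^_; >-nonZero) renaming (_*_ to _*ℕ_; _<_ to _<ℕ_)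
open import Data.Integer using (ℤ)
open import Data.Rational using (_<_; _+_; _/_)
open import Data.Product using (∃-syntax; _×_; _,_)
open import Relation.Nullary using (¬_)

open import Data.Nat as ℕ using (suc; NonZero)
import Data.Nat.Properties as ℕ
open import Data.Nat.Solver using (module +-*-Solver)
import Data.Integer as ℤ
import Data.Integer.Properties as ℤ
open import Data.Rational as ℚ using (ℚ; _*_; _-_; -_; 0ℚ; 1ℚ; fromℚᵘ; toℚᵘ)
open import Data.Rational.Properties
import Data.Rational.Unnormalised as ℚᵘ
import Data.Rational.Unnormalised.Properties as ℚᵘ
open import Relation.Binary.PropositionalEquality using (_≡_; refl; sym; trans; cong; cong₂; subst₂)

fromℚᵘ-homo-+ : ∀ p q → fromℚᵘ (p ℚᵘ.+ q) ≡ fromℚᵘ p + fromℚᵘ q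
fromℚᵘ-homo-+ p q = toℚᵘ-injective (begin
  toℚᵘ (fromℚᵘ (p ℚᵘ.+ q))                  ≈⟨ toℚᵘ-fromℚᵘ (p ℚᵘ.+ q) ⟩
  p ℚᵘ.+ q                                  ≈⟨ ℚᵘ.+-cong (toℚᵘ-fromℚᵘ p) (toℚᵘ-fromℚᵘ q) ⟨
  toℚᵘ (fromℚᵘ p) ℚᵘ.+ toℚᵘ (fromℚᵘ q)      ≈⟨ toℚᵘ-homo-+ (fromℚᵘ p) (fromℚᵘ q) ⟨
  toℚᵘ (fromℚᵘ p + fromℚᵘ q)                ∎)
  where open ℚᵘ.≃-Reasoning

fromℚᵘ-homo-* : ∀ p q → fromℚᵘ (p ℚᵘ.* q) ≡ fromℚᵘ p * fromℚᵘ q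
fromℚᵘ-homo-* p q = toℚᵘ-injective (begin
  toℚᵘ (fromℚᵘ (p ℚᵘ.* q))                  ≈⟨ toℚᵘ-fromℚᵘ (p ℚᵘ.* q) ⟩
  p ℚᵘ.* q                                  ≈⟨ ℚᵘ.*-cong (toℚᵘ-fromℚᵘ p) (toℚᵘ-fromℚᵘ q) ⟨
  toℚᵘ (fromℚᵘ p) ℚᵘ.* toℚᵘ (fromℚᵘ q)      ≈⟨ toℚᵘ-homo-* (fromℚᵘ p) (fromℚᵘ q) ⟨
  toℚᵘ (fromℚᵘ p * fromℚᵘ q)                ∎)
  where open ℚᵘ.≃-Reasoning

fromℚᵘ-homo‿- : ∀ p → fromℚᵘ (ℚᵘ.- p) ≡ - fromℚᵘ p
fromℚᵘ-homo‿- p = toℚᵘ-injective (begin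
  toℚᵘ (fromℚᵘ (ℚᵘ.- p))    ≈⟨ toℚᵘ-fromℚᵘ (ℚᵘ.- p) ⟩
  ℚᵘ.- p                    ≈⟨ ℚᵘ.-‿cong (toℚᵘ-fromℚᵘ p) ⟨
  ℚᵘ.- toℚᵘ (fromℚᵘ p)      ≈⟨ toℚᵘ-homo‿- (fromℚᵘ p) ⟨
  toℚᵘ (- fromℚᵘ p)         ∎)
  where open ℚᵘ.≃-Reasoning

fromℚᵘ-cancel-< : ∀ {p q} → fromℚᵘ p < fromℚᵘ q → p ℚᵘ.< q
fromℚᵘ-cancel-< {p} {q} fp<fq =
  ℚᵘ.<-respʳ-≃ (toℚᵘ-fromℚᵘ q) (ℚᵘ.<-respˡ-≃ (toℚᵘ-fromℚᵘ p) (toℚᵘ-mono-< fp<fq))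

fromℤ : ℤ → ℚ
fromℤ i = i / 1

fromℤ-homo-+ : ∀ i j → fromℤ (i ℤ.+ j) ≡ fromℤ i + fromℤ j
fromℤ-homo-+ i j =
  trans (fromℚᵘ-cong {ℚᵘ.mkℚᵘ (i ℤ.+ j) 0} {i′ ℚᵘ.+ j′} (ℚᵘ.*≡* cross-multiplied)) (fromℚᵘ-homo-+ i′ j′)
  where
  i′ j′ : ℚᵘ.ℚᵘ
  i′ = ℚᵘ.mkℚᵘ i 0
  j′ = ℚᵘ.mkℚᵘ j 0
  cross-multiplied : (i ℤ.+ j) ℤ.* ℤ.+ 1 ≡ (i ℤ.* ℤ.+ 1 ℤ.+ j ℤ.* ℤ.+ 1) ℤ.* ℤ.+ 1
  cross-multiplied = cong (ℤ._* ℤ.+ 1) (sym (cong₂ ℤ._+_ (ℤ.*-identityʳ i) (ℤ.*-identityʳ j)))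

fromℤ-homo-* : ∀ i j → fromℤ (i ℤ.* j) ≡ fromℤ i * fromℤ j
fromℤ-homo-* i j = fromℚᵘ-homo-* (ℚᵘ.mkℚᵘ i 0) (ℚᵘ.mkℚᵘ j 0)

fromℤ-homo‿- : ∀ i → fromℤ (ℤ.- i) ≡ - fromℤ i
fromℤ-homo‿- i = fromℚᵘ-homo‿- (ℚᵘ.mkℚᵘ i 0)

fromℤ-cancel-< : ∀ {i j} → fromℤ i < fromℤ j → i ℤ.< j
fromℤ-cancel-< {i} {j} i<j with fromℚᵘ-cancel-< {ℚᵘ.mkℚᵘ i 0} {ℚᵘ.mkℚᵘ j 0} i<j
... | ℚᵘ.*<* i*1<j*1 = ℤ.*-cancelʳ-<-nonNeg (ℤ.+ 1) i*1<j*1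

IsInteger : ℚ → Set
IsInteger p = ∃[ i ] fromℤ i ≡ p

isInteger-ℕ : ∀ n → IsInteger ⟦ n ⟧
isInteger-ℕ n = ℤ.+ n , refl

isInteger-+ : ∀ {p q} → IsInteger p → IsInteger q → IsInteger (p + q)
isInteger-+ (i , refl) (j , refl) = i ℤ.+ j , fromℤ-homo-+ i j

isInteger-* : ∀ {p q} → IsInteger p → IsInteger q → IsInteger (p * q)
isInteger-* (i , refl) (j , refl) = i ℤ.* j , fromℤ-homo-* i j

isInteger-- : ∀ {p q} → IsInteger p → IsInteger q → IsInteger (p - q)
isInteger-- (i , refl) (j , refl) =
  i ℤ.- j , trans (fromℤ-homo-+ i (ℤ.- j)) (cong (fromℤ i +_) (fromℤ-homo‿- j))

no-integer-in-window : ∀ {x e g} → ∃[ n ] IsInteger n × x ≡ n - e → e ℚ.≤ 1ℚ → g ℚ.≤ e →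
                       ∀ t → ¬ (x < fromℤ t × fromℤ t < x + g)
no-integer-in-window {e = e} {g} (_ , (z , refl) , refl) e≤1 g≤e t (lo , hi) =
  ℤ.<-irrefl refl (ℤ.≤-<-trans (ℤ.i<j⇒i≤pred[j] (fromℤ-cancel-< {t} {z} t<z))
                                (fromℤ-cancel-< {ℤ.pred z} {t} pred[z]<t))
  where
  n : ℚ
  n = fromℤ z
  pred[z]<t : fromℤ (ℤ.pred z) < fromℤ t
  pred[z]<t = ≤-<-trans (begin
    fromℤ (ℤ.pred z)    ≡⟨ fromℤ-homo-+ ℤ.-1ℤ z ⟩
    - 1ℚ + n            ≡⟨ +-comm (- 1ℚ) n ⟩
    n - 1ℚ              ≤⟨ +-monoʳ-≤ n (neg-antimono-≤ e≤1) ⟩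
    n - e               ∎) lo
    where open ≤-Reasoning
  t<z : fromℤ t < n
  t<z = <-≤-trans hi (begin
    n - e + g           ≤⟨ +-monoʳ-≤ (n - e) g≤e ⟩
    n - e + e           ≡⟨ +-assoc n (- e) e ⟩
    n + (- e + e)       ≡⟨ cong (n +_) (+-inverseˡ e) ⟩
    n + 0ℚ              ≡⟨ +-identityʳ n ⟩
    n                   ∎)
    where open ≤-Reasoning

private instance
  B²q²-nonZero : ∀ {q} .{{_ : NonZero q}} → NonZero (B *ℕ B *ℕ (q *ℕ q))
  B²q²-nonZero {q} = ℕ.m*n≢0 (B *ℕ B) (q *ℕ q) {{_}} {{ℕ.m*n≢0 q q}}

+m/c≤+n/d : ∀ m n c d .{{_ : NonZero c}} .{{_ : NonZero d}} →
            m *ℕ d ℕ.≤ n *ℕ c → ℤ.+ m / c ℚ.≤ ℤ.+ n / d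
+m/c≤+n/d m n (suc c) (suc d) md≤nc = toℚᵘ-cancel-≤
  (ℚᵘ.≤-respʳ-≃ (ℚᵘ.≃-sym (toℚᵘ-fromℚᵘ (ℚᵘ.mkℚᵘ (ℤ.+ n) d)))
  (ℚᵘ.≤-respˡ-≃ (ℚᵘ.≃-sym (toℚᵘ-fromℚᵘ (ℚᵘ.mkℚᵘ (ℤ.+ m) c)))
  (ℚᵘ.*≤* (subst₂ ℤ._≤_ (ℤ.pos-* m (suc d)) (ℤ.pos-* n (suc c)) (ℤ.+≤+ md≤nc)))))

20/[B²q²] : (q : ℕ) → .{{NonZero q}} → ℚ
20/[B²q²] q = ℤ.+ 20 / (B *ℕ B *ℕ (q *ℕ q))

20/[B²q²]≤1 : ∀ q .{{_ : NonZero q}} → 20/[B²q²] q ℚ.≤ 1ℚ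
20/[B²q²]≤1 q = +m/c≤+n/d 20 1 (B *ℕ B *ℕ (q *ℕ q)) 1 (begin
  20 *ℕ 1                    ≤⟨ ℕ.m≤m+n 20 5 ⟩
  25                         ≤⟨ ℕ.m≤m*n 25 (q *ℕ q) {{ℕ.m*n≢0 q q}} ⟩
  B *ℕ B *ℕ (q *ℕ q)         ≡⟨ ℕ.*-identityˡ _ ⟨
  1 *ℕ (B *ℕ B *ℕ (q *ℕ q))  ∎)
  where open ℕ.≤-Reasoning

gap≤20/[B²q²] : ∀ p q .{{_ : NonZero q}} → p ℕ.≤ 2 *ℕ q → gap p q ℚ.≤ 20/[B²q²] q
gap≤20/[B²q²] p q p≤2q = +m/c≤+n/d (10 *ℕ p) 20 (B *ℕ B *ℕ (q *ℕ q *ℕ q)) (B *ℕ B *ℕ (q *ℕ q))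
  {{ℕ.m*n≢0 (B *ℕ B) (q *ℕ q *ℕ q) {{_}} {{ℕ.m*n≢0 (q *ℕ q) q {{ℕ.m*n≢0 q q}}}}}} (begin
  10 *ℕ p *ℕ (B *ℕ B *ℕ (q *ℕ q))           ≤⟨ ℕ.*-monoˡ-≤ (B *ℕ B *ℕ (q *ℕ q)) (ℕ.*-monoʳ-≤ 10 p≤2q) ⟩
  10 *ℕ (2 *ℕ q) *ℕ (B *ℕ B *ℕ (q *ℕ q))    ≡⟨ solve 1 (λ q → con 10 :* (con 2 :* q) :* (con 25 :* (q :* q))
                                                          := con 20 :* (con 25 :* (q :* q :* q))) refl q ⟩
  20 *ℕ (B *ℕ B *ℕ (q *ℕ q *ℕ q))           ∎)
  where
  open ℕ.≤-Reasoning
  open +-*-Solver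

F₁-split : ∀ p q .{{_ : NonZero q}} → ∃[ n ] IsInteger n × F₁ p q ≡ n - 20/[B²q²] q
F₁-split p q = _ , b ⊗ b ⊗ (Q ⊗ Q ⊗ Q ⊗ Q ⊗ (Q ⊗ Q)) ⊕ two ⊗ b ⊗ (Q ⊗ Q ⊗ Q ⊗ Q)
                 ⊖ two ⊗ b ⊗ P ⊗ (Q ⊗ Q ⊗ Q) ⊖ two ⊗ (Q ⊗ Q) ⊖ two ⊗ P ⊗ Q ⊕ P ⊗ P ⊕ 5/B , refl
  where
  infixl 6 _⊕_ _⊖_
  infixl 7 _⊗_
  _⊕_ : ∀ {x y} → IsInteger x → IsInteger y → IsInteger (x + y)
  _⊕_ = isInteger-+
  _⊖_ : ∀ {x y} → IsInteger x → IsInteger y → IsInteger (x - y)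
  _⊖_ = isInteger--
  _⊗_ : ∀ {x y} → IsInteger x → IsInteger y → IsInteger (x * y)
  _⊗_ = isInteger-*
  P : IsInteger ⟦ p ⟧
  P = isInteger-ℕ p
  Q : IsInteger ⟦ q ⟧
  Q = isInteger-ℕ q
  b : IsInteger ⟦ B ⟧
  b = isInteger-ℕ B
  two : IsInteger ⟦ 2 ⟧
  two = isInteger-ℕ 2
  5/B : IsInteger (ℤ.+ 5 / B)
  5/B = ℤ.+ 1 , refl

no-integer-between-F₁-and-F₁+gap : ∀ p q .{{_ : NonZero q}} → p ℕ.≤ 2 *ℕ q →
                                   ∀ t → ¬ (F₁ p q < fromℤ t × fromℤ t < F₁ p q + gap p q)
no-integer-between-F₁-and-F₁+gap p q p≤2q =
  no-integer-in-window (F₁-split p q) (20/[B²q²]≤1 q) (gap≤20/[B²q²] p q p≤2q)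

theorem7p3 : (p q : ℕ) → 0 <ℕ p → (q>0 : 0 <ℕ q) → (3600 ^ 3) *ℕ p ≤ q ^ 3 → p <ℕ 2 *ℕ q
    → ¬ (∃[ t ] (F₁ p q {{>-nonZero q>0}} < t / 1 × t / 1 < F₁ p q {{>-nonZero q>0}} + gap p q {{>-nonZero q>0}}))
theorem7p3 p q _ q>0 _ p<2q (t , bounds) =
  no-integer-between-F₁-and-F₁+gap p q {{>-nonZero q>0}} (ℕ.<⇒≤ p<2q) t bounds
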